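{- Let $k\ge1$. For $1\le s\le k$ and $m\ge j\ge1$, \[ GL_k(k(m-1)+s,j)+GL_k(k(m-1)+s,\overline{j})=(z^{j-1}+z^j)q^{k\binom{j}{2}+sj+k(m-j)}{m-1\brack j-1}_k. \]
   Context: Overpartitions here are non-increasing sequences of positive integers in which the last occurrence of each distinct part value may be overlined; a part $t$ or $\overline t$ has size $t$, written $|\cdot|=t$; $|\lambda|$ is the sum of part sizes and $\ell_o(\lambda)$ the number of overlined parts. An $L_k$-overpartition is an overpartition $\pi=(\pi_1,\ldots,\pi_\ell)$ such that whenever $\pi_i$ is overlined, $\ell-i\equiv 0\pmod k$. For $m\ge1$, $\mathcal{BL}_k(m)$ is the set of $L_k$-overpartitions $\lambda=(\lambda_1,\ldots,\lambda_m)$ with exactly $m$ parts such that $\lambda_m=\overline1$ or $1$, and for $1\le i<m$, $|\lambda_i|\le|\lambda_{i+1}|+1$, with strict inequality if $\lambda_i$ is non-overlined. For $m,j\ge1$, $\mathcal{BL}_k(m,j)$ (resp. $\mathcal{BL}_k(m,\overline j)$) is the set of overpartitions in $\mathcal{BL}_k(m)$ whose largest part is $j$ (resp. $\overline j$), and $GL_k(m,j)=\sum_{\lambda\in\mathcal{BL}_k(m,j)}z^{\ell_o(\lambda)}q^{|\lambda|}$, $GL_k(m,\overline j)=\sum_{\lambda\in\mathcal{BL}_k(m,\overline j)}z^{\ell_o(\lambda)}q^{|\lambda|}$. Also ${A\brack B}_k=\frac{(q^k;q^k)_A}{(q^k;q^k)_B(q^k;q^k)_{A-B}}$ for $A\ge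 B\ge0$ and $0$ otherwise, with $(a;q)_n=\prod_{i=0}^{n-1}(1-aq^i)$. -}

module Defs where

open import Data.Nat using (ℕ; zero; suc; _+_; _*_; _∸_; _≤ᵇ_; _<ᵇ_; _≡ᵇ_)
open import Data.Nat.Divisibility using (_∣?_)
open import Data.Integer as ℤ using (ℤ; +_)
open import Data.Bool using (Bool; true; false; _∧_; _∨_; not; if_then_else_)
open import Data.Product using (_×_; _,_; proj₁; proj₂)
open import Data.List using (List; []; _∷_; length; map; concatMap; upTo; filterᵇ; foldr)
open import Relation.Nullary.Decidable using (⌊_⌋)
open import Relation.Binary.PropositionalEquality using (_≡_)

-- Overpartitions
-- A part is a pair (t , o): size t, overlined iff o ≡ true.
-- An overpartition (π₁,…,π_ℓ) is the list π₁ ∷ … ∷ π_ℓ ∷ [].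

Part : Set
Part = ℕ × Bool

size : Part → ℕ
size = proj₁

over : Part → Bool
over = proj₂

allPositive : List Part → Bool
allPositive []      = true
allPositive (p ∷ r) = (1 ≤ᵇ size p) ∧ allPositive r

-- non-increasing, and an overlined part is the last occurrence of its value
overChain : List Part → Bool
overChain []             = true
overChain (p ∷ [])       = true
overChain (p ∷ p' ∷ r)   =
  (size p' ≤ᵇ size p)
  ∧ (if over p then size p' <ᵇ size p else true)
  ∧ overChain (p' ∷ r)

isOverpartition : List Part → Bool
isOverpartition π = allPositive π ∧ overChain π

-- L_k condition: if π_i is overlined then k ∣ (ℓ - i).
-- For π = … ∷ p ∷ r with p = π_i, we have ℓ - i = length r.
isLk : ℕ → List Part → Bool
isLk k []      = true
isLk k (p ∷ r) = (not (over p) ∨ ⌊ k ∣? length r ⌋) ∧ isLk k r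

lastIsOne : List Part → Bool
lastIsOne []       = false
lastIsOne (p ∷ []) = size p ≡ᵇ 1
lastIsOne (p ∷ r@(_ ∷ _)) = lastIsOne r

blChain : List Part → Bool
blChain []           = true
blChain (p ∷ [])     = true
blChain (p ∷ p' ∷ r) =
  (size p ≤ᵇ size p' + 1)
  ∧ (if over p then true else size p <ᵇ size p' + 1)
  ∧ blChain (p' ∷ r)

isBL : ℕ → ℕ → List Part → Bool
isBL k m λ' = isOverpartition λ' ∧ isLk k λ' ∧ (length λ' ≡ᵇ m) ∧ lastIsOne λ' ∧ blChain λ'

largestIs : ℕ → Bool → List Part → Bool
largestIs j o []      = false
largestIs j o (p ∷ _) = (size p ≡ᵇ j) ∧ (if o then over p else not (over p))

weight : List Part → ℕ
weight = foldr (λ p n → size p + n) 0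

numOver : List Part → ℕ
numOver = foldr (λ p n → (if over p then 1 else 0) + n) 0

partsUpTo : ℕ → List Part
partsUpTo b = concatMap (λ t → (suc t , false) ∷ (suc t , true) ∷ []) (upTo b)

listsOf : ℕ → ℕ → List (List Part)
listsOf zero    b = [] ∷ []
listsOf (suc n) b = concatMap (λ p → map (p ∷_) (listsOf n b)) (partsUpTo b)

-- Formal power series in z and q with integer coefficients:
-- F a b = coefficient of z^a q^b.

PS : Set
PS = ℕ → ℕ → ℤ

_≈ₚ_ : PS → PS → Set
F ≈ₚ G = ∀ a b → F a b ≡ G a b

sumℤ : List ℤ → ℤ
sumℤ = foldr ℤ._+_ (+ 0)

_⊕_ : PS → PS → PS
(F ⊕ G) a b = F a b ℤ.+ G a b

_⊖_ : PS → PS → PS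
(F ⊖ G) a b = F a b ℤ.- G a b

_⊛_ : PS → PS → PS
(F ⊛ G) a b =
  sumℤ (concatMap (λ i → map (λ j → F i j ℤ.* G (a ∸ i) (b ∸ j)) (upTo (suc b))) (upTo (suc a)))

infixl 6 _⊕_ _⊖_
infix 4 _≈ₚ_
infixl 7 _⊛_

mono : ℕ → ℕ → PS
mono e f a b = if (a ≡ᵇ e) ∧ (b ≡ᵇ f) then + 1 else + 0

one : PS
one = mono 0 0

poch : ℕ → ℕ → PS
poch k zero    = one
poch k (suc n) = poch k n ⊛ (one ⊖ mono 0 (k * suc n))

-- 1/(1 - q^c) = Σ_{r≥0} q^{cr}  (used for c ≥ 1)
geom : ℕ → PS
geom c a b = if (a ≡ᵇ 0) ∧ ⌊ c ∣? b ⌋ then + 1 else + 0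

invPoch : ℕ → ℕ → PS
invPoch k zero    = one
invPoch k (suc n) = invPoch k n ⊛ geom (k * suc n)

qbinom : ℕ → ℕ → ℕ → PS
qbinom k A B =
  if B ≤ᵇ A then poch k A ⊛ invPoch k B ⊛ invPoch k (A ∸ B) else (λ _ _ → + 0)

-- GL_k(m,j) (o = false) and GL_k(m, j̄) (o = true).  Every such λ has all part sizes in {1,…,b},
-- so it occurs in listsOf m b.

GL : ℕ → ℕ → ℕ → Bool → PS
GL k m j o a b =
  + length (filterᵇ (λ λ' → isBL k m λ' ∧ largestIs j o λ' ∧ (numOver λ' ≡ᵇ a) ∧ (weight λ' ≡ᵇ b))
                   (listsOf m b))

{-# OPTIONS --safe #-}
module Submission where

-- Deleting the largest part λ₁ of λ ∈ BL_k(N+1) leaves an element of BL_k(N) whose largest part has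
-- size |λ₁| if λ₁ is not overlined, and size |λ₁| − 1 if it is; the second case is possible exactly
-- when k ∣ N (the L_k condition for λ₁).  So G_N(j) = GL_k(N,j) + GL_k(N,j̄) satisfies
--   G_{N+1}(j) = q^j G_N(j) + [k ∣ N] z q^j G_N(j−1),
-- with G_1(1) = 1 + z.  Writing N = k(m−1) + s, the steps s → s+1 (k ∤ N) multiply the closed form by
-- q^j, and the step from s = k to s = 1, m → m+1 (k ∣ N) is the q-Pascal rule
--   [m, j−1] = [m−1, j−2] + q^{k(j−1)} [m−1, j−1].
-- Power series in z and q are manipulated in the commutative ring ℤ[[q]][[z]], whose Cauchy product
-- computes the same coefficients as _⊛_.

open import Level using (0ℓ)
open import Algebra.Bundles using (CommutativeMonoid; CommutativeRing)
open import Algebra.Structures using (IsCommutativeRing)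
open import Data.Bool using (Bool; true; false; if_then_else_; _∧_; _∨_; not)
open import Data.Bool.Properties using (∧-assoc; ∧-zeroʳ; ∧-conicalʳ; ∧-commutativeMonoid; T-≡)
open import Data.Empty using (⊥-elim)
open import Data.Integer as ℤ using (ℤ; +_)
import Data.Integer.Properties as ℤ
open import Data.List using (List; []; _∷_; _++_; length; map; concatMap; upTo; applyUpTo; filterᵇ)
open import Data.List.Properties using (concatMap-++)
open import Data.List.Relation.Unary.All as All using (All; []; _∷_)
open import Data.List.Relation.Unary.All.Properties using (concat⁺; map⁺)
open import Data.Nat as ℕ using (ℕ; zero; suc; _∸_; _≤_; _<_; z≤n; s≤s; _≡ᵇ_; _≤ᵇ_; _<ᵇ_)
import Data.Nat.Properties as ℕ
open import Data.Nat.Properties using (_≟_; _≤?_)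
open import Data.Nat.Combinatorics using (_C_; nCk+nC[k+1]≡[n+1]C[k+1]; nC1≡n)
open import Data.Nat.Divisibility
  using (_∣_; _∣?_; _∣0; m∣m*n; ∣m+n∣m⇒∣n; ∣m∣n⇒∣m+n; ∣m∸n∣n⇒∣m; ∣-refl; ∣⇒≤; >⇒∤)
open import Data.Nat.Tactic.RingSolver using (solve-∀)
open import Data.Product using (_,_)
open import Function using (_∘_; Equivalence)
open import Relation.Binary.PropositionalEquality as ≡ using (_≡_; _≢_)
open import Relation.Binary.Definitions using (tri<; tri≈; tri>)
open import Relation.Nullary using (yes; no; ¬_)
open import Relation.Nullary.Decidable using (⌊_⌋; dec-true; dec-false)
import Algebra.Solver.CommutativeMonoid ∧-commutativeMonoid as ∧-Solver

open import Defs

≡ᵇ-true : ∀ {m n} → m ≡ n → (m ≡ᵇ n) ≡ true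
≡ᵇ-true {m} {n} = dec-true (m ≟ n)

≡ᵇ-false : ∀ {m n} → m ≢ n → (m ≡ᵇ n) ≡ false
≡ᵇ-false {m} {n} = dec-false (m ≟ n)

≤ᵇ-true : ∀ {m n} → m ≤ n → (m ≤ᵇ n) ≡ true
≤ᵇ-true {m} {n} = dec-true (m ≤? n)

≤ᵇ-false : ∀ {m n} → ¬ m ≤ n → (m ≤ᵇ n) ≡ false
≤ᵇ-false {m} {n} = dec-false (m ≤? n)

module FiniteSum {c ℓ} (M : CommutativeMonoid c ℓ) where

  open CommutativeMonoid M
  open import Algebra.Properties.CommutativeSemigroup commutativeSemigroup using (interchange)
  open import Relation.Binary.Reasoning.Setoid setoid

  ∑ : ℕ → (ℕ → Carrier) → Carrier
  ∑ zero    f = ε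
  ∑ (suc n) f = f 0 ∙ ∑ n (f ∘ suc)

  ∑-cong< : ∀ n {f g} → (∀ i → i < n → f i ≈ g i) → ∑ n f ≈ ∑ n g
  ∑-cong< zero    f≈g = refl
  ∑-cong< (suc n) f≈g = ∙-cong (f≈g 0 (s≤s z≤n)) (∑-cong< n (λ i i<n → f≈g (suc i) (s≤s i<n)))

  ∑-cong : ∀ n {f g} → (∀ i → f i ≈ g i) → ∑ n f ≈ ∑ n g
  ∑-cong n f≈g = ∑-cong< n (λ i _ → f≈g i)

  ∑-ε : ∀ n {f} → (∀ i → i < n → f i ≈ ε) → ∑ n f ≈ ε
  ∑-ε zero    f≈ε = refl
  ∑-ε (suc n) f≈ε = trans (∙-cong (f≈ε 0 (s≤s z≤n)) (∑-ε n (λ i i<n → f≈ε (suc i) (s≤s i<n)))) (identityˡ ε)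

  ∑-single : ∀ n p {f} → p < n → (∀ i → i ≢ p → f i ≈ ε) → ∑ n f ≈ f p
  ∑-single (suc n) zero    p<n f≈ε =
    trans (∙-congˡ (∑-ε n (λ i _ → f≈ε (suc i) (λ ())))) (identityʳ _)
  ∑-single (suc n) (suc p) (s≤s p<n) f≈ε =
    trans (∙-cong (f≈ε 0 (λ ())) (∑-single n p p<n (λ i i≢p → f≈ε (suc i) (i≢p ∘ ℕ.suc-injective))))
          (identityˡ _)

  ∑-distrib : ∀ n f g → ∑ n (λ i → f i ∙ g i) ≈ ∑ n f ∙ ∑ n g
  ∑-distrib zero    f g = sym (identityˡ ε)
  ∑-distrib (suc n) f g = trans (∙-congˡ (∑-distrib n (f ∘ suc) (g ∘ suc))) (interchange _ _ _ _)

  ∑-split : ∀ m n f → ∑ (m ℕ.+ n) f ≈ ∑ m f ∙ ∑ n (λ i → f (m ℕ.+ i))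
  ∑-split zero    n f = sym (identityˡ _)
  ∑-split (suc m) n f = trans (∙-congˡ (∑-split m n (f ∘ suc))) (sym (assoc _ _ _))

  ∑-snoc : ∀ n f → ∑ (suc n) f ≈ ∑ n f ∙ f n
  ∑-snoc zero    f = trans (identityʳ _) (sym (identityˡ _))
  ∑-snoc (suc n) f = trans (∙-congˡ (∑-snoc n (f ∘ suc))) (sym (assoc _ _ _))

  ∑-reverse : ∀ n f → ∑ n f ≈ ∑ n (λ i → f (n ∸ suc i))
  ∑-reverse zero    f = refl
  ∑-reverse (suc n) f = begin
    f 0 ∙ ∑ n (f ∘ suc)                    ≈⟨ ∙-congˡ (∑-reverse n (f ∘ suc)) ⟩
    f 0 ∙ ∑ n (λ i → f (suc (n ∸ suc i)))  ≈⟨ ∙-congˡ (∑-cong< n (λ i i<n →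
                                                 reflexive (≡.cong f (≡.sym (ℕ.+-∸-assoc 1 i<n))))) ⟩
    f 0 ∙ ∑ n (λ i → f (n ∸ i))            ≈⟨ comm _ _ ⟩
    ∑ n (λ i → f (n ∸ i)) ∙ f 0            ≈⟨ ∙-congˡ (reflexive (≡.cong f (≡.sym (ℕ.n∸n≡0 n)))) ⟩
    ∑ n (λ i → f (n ∸ i)) ∙ f (n ∸ n)      ≈⟨ ∑-snoc n (λ i → f (n ∸ i)) ⟨
    ∑ (suc n) (λ i → f (n ∸ i))            ∎

  ∑-triangle : ∀ n (f : ℕ → ℕ → Carrier) →
    ∑ (suc n) (λ i → ∑ (suc i) (λ j → f j i)) ≈ ∑ (suc n) (λ j → ∑ (suc (n ∸ j)) (λ l → f j (j ℕ.+ l)))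
  ∑-triangle zero    f = refl
  ∑-triangle (suc n) f = begin
    (f 0 0 ∙ ε) ∙ ∑ (suc n) (λ i → f 0 (suc i) ∙ ∑ (suc i) (λ j → f (suc j) (suc i)))
      ≈⟨ ∙-cong (identityʳ _) (∑-distrib (suc n) (λ i → f 0 (suc i)) (λ i → ∑ (suc i) (λ j → f (suc j) (suc i)))) ⟩
    f 0 0 ∙ (∑ (suc n) (λ i → f 0 (suc i)) ∙ ∑ (suc n) (λ i → ∑ (suc i) (λ j → f (suc j) (suc i))))
      ≈⟨ ∙-congˡ (∙-congˡ (∑-triangle n (λ j i → f (suc j) (suc i)))) ⟩
    f 0 0 ∙ (∑ (suc n) (λ i → f 0 (suc i)) ∙ ∑ (suc n) (λ j → ∑ (suc (n ∸ j)) (λ l → f (suc j) (suc (j ℕ.+ l)))))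
      ≈⟨ assoc _ _ _ ⟨
    (f 0 0 ∙ ∑ (suc n) (λ i → f 0 (suc i))) ∙ ∑ (suc n) (λ j → ∑ (suc (n ∸ j)) (λ l → f (suc j) (suc (j ℕ.+ l))))
      ∎
module PowerSeries (R : CommutativeRing 0ℓ 0ℓ) where

  open CommutativeRing R hiding (isCommutativeRing)
  open FiniteSum +-commutativeMonoid public
  open import Relation.Binary.Reasoning.Setoid setoid

  Series : Set
  Series = ℕ → Carrier

  infix  4 _≋_
  infixl 6 _+ₛ_
  infixl 7 _*ₛ_

  _≋_ : Series → Series → Set
  F ≋ G = ∀ n → F n ≈ G n

  _+ₛ_ _*ₛ_ : Series → Series → Series
  (F +ₛ G) n = F n + G n
  (F *ₛ G) n = ∑ (suc n) (λ i → F i * G (n ∸ i))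

  -ₛ_ : Series → Series
  (-ₛ F) n = - F n

  0ₛ 1ₛ : Series
  0ₛ _       = 0#
  1ₛ zero    = 1#
  1ₛ (suc _) = 0#

  ∑-*ˡ : ∀ n x f → x * ∑ n f ≈ ∑ n (λ i → x * f i)
  ∑-*ˡ zero    x f = zeroʳ x
  ∑-*ˡ (suc n) x f = trans (distribˡ x _ _) (+-congˡ (∑-*ˡ n x (f ∘ suc)))

  ∑-*ʳ : ∀ n x f → ∑ n f * x ≈ ∑ n (λ i → f i * x)
  ∑-*ʳ n x f = trans (*-comm _ x) (trans (∑-*ˡ n x f) (∑-cong n (λ i → *-comm x (f i))))

  *ₛ-cong : ∀ {F F′ G G′} → F ≋ F′ → G ≋ G′ → F *ₛ G ≋ F′ *ₛ G′
  *ₛ-cong F≋F′ G≋G′ n = ∑-cong (suc n) (λ i → *-cong (F≋F′ i) (G≋G′ (n ∸ i)))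

  *ₛ-comm : ∀ F G → F *ₛ G ≋ G *ₛ F
  *ₛ-comm F G n = begin
    ∑ (suc n) (λ i → F i * G (n ∸ i))               ≈⟨ ∑-reverse (suc n) (λ i → F i * G (n ∸ i)) ⟩
    ∑ (suc n) (λ i → F (n ∸ i) * G (n ∸ (n ∸ i)))   ≈⟨ ∑-cong< (suc n) (λ i i≤n → trans (*-comm (F (n ∸ i)) _)
                                                          (*-congʳ (reflexive (≡.cong G (ℕ.m∸[m∸n]≡n (ℕ.≤-pred i≤n)))))) ⟩
    ∑ (suc n) (λ i → G i * F (n ∸ i))               ∎

  *ₛ-assoc : ∀ F G H → (F *ₛ G) *ₛ H ≋ F *ₛ (G *ₛ H)
  *ₛ-assoc F G H n = begin
    ∑ (suc n) (λ i → ∑ (suc i) (λ j → F j * G (i ∸ j)) * H (n ∸ i))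
      ≈⟨ ∑-cong (suc n) (λ i → ∑-*ʳ (suc i) (H (n ∸ i)) (λ j → F j * G (i ∸ j))) ⟩
    ∑ (suc n) (λ i → ∑ (suc i) (λ j → F j * G (i ∸ j) * H (n ∸ i)))
      ≈⟨ ∑-triangle n (λ j i → F j * G (i ∸ j) * H (n ∸ i)) ⟩
    ∑ (suc n) (λ j → ∑ (suc (n ∸ j)) (λ l → F j * G (j ℕ.+ l ∸ j) * H (n ∸ (j ℕ.+ l))))
      ≈⟨ ∑-cong (suc n) (λ j → ∑-cong (suc (n ∸ j)) (λ l →
           trans (*-assoc (F j) (G (j ℕ.+ l ∸ j)) (H (n ∸ (j ℕ.+ l))))
                 (*-congˡ (*-cong (reflexive (≡.cong G (ℕ.m+n∸m≡n j l)))
                                  (reflexive (≡.cong H (≡.sym (ℕ.∸-+-assoc n j l)))))))) ⟩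
    ∑ (suc n) (λ j → ∑ (suc (n ∸ j)) (λ l → F j * (G l * H (n ∸ j ∸ l))))
      ≈⟨ ∑-cong (suc n) (λ j → ∑-*ˡ (suc (n ∸ j)) (F j) (λ l → G l * H (n ∸ j ∸ l))) ⟨
    ∑ (suc n) (λ j → F j * ∑ (suc (n ∸ j)) (λ l → G l * H (n ∸ j ∸ l))) ∎

  *ₛ-identityˡ : ∀ F → 1ₛ *ₛ F ≋ F
  *ₛ-identityˡ F n = trans (+-cong (*-identityˡ (F n)) (∑-ε n (λ i _ → zeroˡ _))) (+-identityʳ _)

  *ₛ-distribˡ : ∀ F G H → F *ₛ (G +ₛ H) ≋ F *ₛ G +ₛ F *ₛ H
  *ₛ-distribˡ F G H n = trans (∑-cong (suc n) (λ i → distribˡ (F i) (G (n ∸ i)) (H (n ∸ i))))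
                              (∑-distrib (suc n) (λ i → F i * G (n ∸ i)) (λ i → F i * H (n ∸ i)))

  isCommutativeRing : IsCommutativeRing _≋_ _+ₛ_ _*ₛ_ -ₛ_ 0ₛ 1ₛ
  isCommutativeRing = record
    { isRing = record
      { +-isAbelianGroup = record
        { isGroup = record
          { isMonoid = record
            { isSemigroup = record
              { isMagma = record
                { isEquivalence = record
                  { refl = λ _ → refl ; sym = λ F≋G n → sym (F≋G n) ; trans = λ F≋G G≋H n → trans (F≋G n) (G≋H n) }
                ; ∙-cong = λ F≋F′ G≋G′ n → +-cong (F≋F′ n) (G≋G′ n) }
              ; assoc = λ F G H n → +-assoc (F n) (G n) (H n) }
            ; identity = (λ F n → +-identityˡ (F n)) , (λ F n → +-identityʳ (F n)) }
          ; inverse = (λ F n → -‿inverseˡ (F n)) , (λ F n → -‿inverseʳ (F n))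
          ; ⁻¹-cong = λ F≋G n → -‿cong (F≋G n) }
        ; comm = λ F G n → +-comm (F n) (G n) }
      ; *-cong = *ₛ-cong
      ; *-assoc = *ₛ-assoc
      ; *-identity = *ₛ-identityˡ , (λ F n → trans (*ₛ-comm F 1ₛ n) (*ₛ-identityˡ F n))
      ; distrib = *ₛ-distribˡ , (λ F G H n → trans (*ₛ-comm (G +ₛ H) F n)
                    (trans (*ₛ-distribˡ F G H n) (+-cong (*ₛ-comm F G n) (*ₛ-comm F H n)))) }
    ; *-comm = *ₛ-comm }

  commutativeRing : CommutativeRing 0ℓ 0ℓ
  commutativeRing = record { isCommutativeRing = isCommutativeRing }

  monomial : ℕ → Carrier → Series
  monomial e x n = if n ≡ᵇ e then x else 0#

  monomial-off : ∀ {e i} x y → i ≢ e → monomial e x i * y ≈ 0#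
  monomial-off x y i≢e rewrite ≡ᵇ-false i≢e = zeroˡ y

  monomial-*ₛ : ∀ e x F n → (monomial e x *ₛ F) n ≈ (if e ≤ᵇ n then x * F (n ∸ e) else 0#)
  monomial-*ₛ e x F n with e ≤? n
  ... | yes e≤n rewrite ≤ᵇ-true e≤n =
    trans (∑-single (suc n) e {term} (s≤s e≤n) (λ i i≢e → monomial-off {e} {i} x (F (n ∸ i)) i≢e))
          (*-congʳ (reflexive (≡.cong (if_then x else 0#) (≡ᵇ-true {e} ≡.refl))))
    where
    term : ℕ → Carrier
    term i = monomial e x i * F (n ∸ i)
  ... | no  e≰n rewrite ≤ᵇ-false e≰n =
    ∑-ε (suc n) {term} (λ i i≤n → monomial-off {e} {i} x (F (n ∸ i)) (λ { ≡.refl → e≰n (ℕ.≤-pred i≤n) }))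
    where
    term : ℕ → Carrier
    term i = monomial e x i * F (n ∸ i)

module _ {c ℓ} (R : CommutativeRing c ℓ) where

  open CommutativeRing R
  open import Algebra.Properties.Ring ring using (x[y-z]≈xy-xz)
  open import Relation.Binary.Reasoning.Setoid setoid

  1-xy≈[1-x]+x[1-y] : ∀ x y → 1# - x * y ≈ (1# - x) + x * (1# - y)
  1-xy≈[1-x]+x[1-y] x y = sym (begin
    (1# - x) + x * (1# - y)      ≈⟨ +-congˡ (x[y-z]≈xy-xz x 1# y) ⟩
    (1# - x) + (x * 1# - x * y)  ≈⟨ +-congˡ (+-congʳ (*-identityʳ x)) ⟩
    (1# - x) + (x - x * y)       ≈⟨ +-assoc 1# (- x) (x - x * y) ⟩
    1# + (- x + (x - x * y))     ≈⟨ +-congˡ (+-assoc (- x) x (- (x * y))) ⟨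
    1# + ((- x + x) - x * y)     ≈⟨ +-congˡ (+-congʳ (-‿inverseˡ x)) ⟩
    1# + (0# - x * y)            ≈⟨ +-congˡ (+-identityˡ (- (x * y))) ⟩
    1# - x * y                   ∎)

open import Data.Nat using (_+_; _*_)
open ≡ using (refl; cong; cong₂)

∸-≡ᵇ : ∀ {e a} e′ → e ≤ a → (a ∸ e ≡ᵇ e′) ≡ (a ≡ᵇ e + e′)
∸-≡ᵇ e′ z≤n       = refl
∸-≡ᵇ e′ (s≤s e≤a) = ∸-≡ᵇ e′ e≤a

+-≡ᵇ : ∀ {e a} e′ → e ≤ a → (e + e′ ≡ᵇ a) ≡ (e′ ≡ᵇ a ∸ e)
+-≡ᵇ e′ z≤n       = refl
+-≡ᵇ e′ (s≤s e≤a) = +-≡ᵇ e′ e≤a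

<⇒≡ᵇ+-false : ∀ {e a} e′ → a < e → (a ≡ᵇ e + e′) ≡ false
<⇒≡ᵇ+-false {e} e′ a<e =
  ≡ᵇ-false (λ a≡e+e′ → ℕ.<⇒≱ a<e (≡.subst (e ≤_) (≡.sym a≡e+e′) (ℕ.m≤m+n e e′)))

suc-≡ᵇ : ∀ x a → (suc x ≡ᵇ a) ≡ (1 ≤ᵇ a) ∧ (x ≡ᵇ a ∸ 1)
suc-≡ᵇ x zero    = refl
suc-≡ᵇ x (suc a) = refl

d∣n⇒d∣n∸d : ∀ {d n} → d ≤ n → d ∣ n → d ∣ n ∸ d
d∣n⇒d∣n∸d d≤n d∣n = ∣m+n∣m⇒∣n (≡.subst (_ ∣_) (≡.sym (ℕ.m+[n∸m]≡n d≤n)) d∣n) ∣-refl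

k∣?0 : ∀ k → ⌊ k ∣? 0 ⌋ ≡ true
k∣?0 k with k ∣? 0
... | yes _   = refl
... | no  k∤0 = ⊥-elim (k∤0 (k ∣0))

k∤k*m+s : ∀ k m {s} → 1 ≤ s → s < k → ¬ k ∣ k * m + s
k∤k*m+s k m {suc s} _ s<k k∣ = ℕ.<⇒≱ s<k (∣⇒≤ (∣m+n∣m⇒∣n k∣ (m∣m*n m)))

k∣k*m+k : ∀ k m → k ∣ k * m + k
k∣k*m+k k m = ∣m∣n⇒∣m+n (m∣m*n m) ∣-refl

-- ℤ[[q]] and ℤ[[q]][[z]]: the carrier, sum, negation and zero of the latter are literally PS, _⊕_, … of Defs.
module Q  = PowerSeries ℤ.+-*-commutativeRing
module ZQ = PowerSeries Q.commutativeRing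
module ZQ-Ring = CommutativeRing ZQ.commutativeRing

sumℤ-++ : ∀ xs ys → sumℤ (xs ++ ys) ≡ sumℤ xs ℤ.+ sumℤ ys
sumℤ-++ []       ys = ≡.sym (ℤ.+-identityˡ _)
sumℤ-++ (x ∷ xs) ys = ≡.trans (cong (λ t → x ℤ.+ t) (sumℤ-++ xs ys)) (≡.sym (ℤ.+-assoc x _ _))

sumℤ-map-applyUpTo : ∀ (h : ℕ → ℤ) f n → sumℤ (map h (applyUpTo f n)) ≡ Q.∑ n (h ∘ f)
sumℤ-map-applyUpTo h f zero    = refl
sumℤ-map-applyUpTo h f (suc n) = cong (λ t → h (f 0) ℤ.+ t) (sumℤ-map-applyUpTo h (f ∘ suc) n)

sumℤ-concatMap-applyUpTo : ∀ (g : ℕ → List ℤ) f n →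
  sumℤ (concatMap g (applyUpTo f n)) ≡ Q.∑ n (sumℤ ∘ g ∘ f)
sumℤ-concatMap-applyUpTo g f zero    = refl
sumℤ-concatMap-applyUpTo g f (suc n) = ≡.trans (sumℤ-++ (g (f 0)) _)
  (cong (λ t → sumℤ (g (f 0)) ℤ.+ t) (sumℤ-concatMap-applyUpTo g (f ∘ suc) n))

ZQ-∑-apply : ∀ n (H : ℕ → Q.Series) b → ZQ.∑ n H b ≡ Q.∑ n (λ i → H i b)
ZQ-∑-apply zero    H b = refl
ZQ-∑-apply (suc n) H b = cong (λ t → H 0 b ℤ.+ t) (ZQ-∑-apply n (H ∘ suc) b)

⊛≈*ₛ : ∀ F G → F ⊛ G ≈ₚ F ZQ.*ₛ G
⊛≈*ₛ F G a b = begin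
  sumℤ (concatMap (λ i → map (term i) (upTo (suc b))) (upTo (suc a)))
    ≡⟨ sumℤ-concatMap-applyUpTo (λ i → map (term i) (upTo (suc b))) (λ i → i) (suc a) ⟩
  Q.∑ (suc a) (λ i → sumℤ (map (term i) (upTo (suc b))))
    ≡⟨ Q.∑-cong (suc a) (λ i → sumℤ-map-applyUpTo (term i) (λ j → j) (suc b)) ⟩
  Q.∑ (suc a) (λ i → (F i Q.*ₛ G (a ∸ i)) b)
    ≡⟨ ZQ-∑-apply (suc a) (λ i → F i Q.*ₛ G (a ∸ i)) b ⟨
  (F ZQ.*ₛ G) a b ∎
  where
  open ≡.≡-Reasoning
  term : ℕ → ℕ → ℤ
  term i j = F i j ℤ.* G (a ∸ i) (b ∸ j)

one≈1ₛ : one ≈ₚ ZQ.1ₛ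
one≈1ₛ zero    zero    = refl
one≈1ₛ zero    (suc b) = refl
one≈1ₛ (suc a) zero    = refl
one≈1ₛ (suc a) (suc b) = refl

⊛-cong : ∀ {F F′ G G′} → F ≈ₚ F′ → G ≈ₚ G′ → F ⊛ G ≈ₚ F′ ⊛ G′
⊛-cong {F} {F′} {G} {G′} F≈F′ G≈G′ =
  ZQ-Ring.trans (⊛≈*ₛ F G) (ZQ-Ring.trans (ZQ.*ₛ-cong F≈F′ G≈G′) (ZQ-Ring.sym (⊛≈*ₛ F′ G′)))

⊛-assoc : ∀ F G H → (F ⊛ G) ⊛ H ≈ₚ F ⊛ (G ⊛ H)
⊛-assoc F G H = begin
  (F ⊛ G) ⊛ H              ≈⟨ ⊛≈*ₛ (F ⊛ G) H ⟩
  (F ⊛ G) ZQ.*ₛ H          ≈⟨ ZQ-Ring.*-congʳ {H} (⊛≈*ₛ F G) ⟩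
  (F ZQ.*ₛ G) ZQ.*ₛ H      ≈⟨ ZQ.*ₛ-assoc F G H ⟩
  F ZQ.*ₛ (G ZQ.*ₛ H)      ≈⟨ ZQ-Ring.*-congˡ {F} (⊛≈*ₛ G H) ⟨
  F ZQ.*ₛ (G ⊛ H)          ≈⟨ ⊛≈*ₛ F (G ⊛ H) ⟨
  F ⊛ (G ⊛ H)              ∎
  where open import Relation.Binary.Reasoning.Setoid ZQ-Ring.setoid

⊛-comm : ∀ F G → F ⊛ G ≈ₚ G ⊛ F
⊛-comm F G = ZQ-Ring.trans (⊛≈*ₛ F G) (ZQ-Ring.trans (ZQ.*ₛ-comm F G) (ZQ-Ring.sym (⊛≈*ₛ G F)))

⊛-identityˡ : ∀ F → one ⊛ F ≈ₚ F
⊛-identityˡ F = ZQ-Ring.trans (⊛≈*ₛ one F) (ZQ-Ring.trans (ZQ-Ring.*-congʳ {F} one≈1ₛ) (ZQ.*ₛ-identityˡ F))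

⊛-distribˡ : ∀ F G H → F ⊛ (G ⊕ H) ≈ₚ F ⊛ G ⊕ F ⊛ H
⊛-distribˡ F G H = ZQ-Ring.trans (⊛≈*ₛ F (G ⊕ H))
  (ZQ-Ring.trans (ZQ.*ₛ-distribˡ F G H) (ZQ-Ring.sym (ZQ-Ring.+-cong {F ⊛ G} {F ZQ.*ₛ G} (⊛≈*ₛ F G) (⊛≈*ₛ F H))))

PS-commutativeRing : CommutativeRing 0ℓ 0ℓ
PS-commutativeRing = record
  { Carrier = PS ; _≈_ = _≈ₚ_ ; _+_ = _⊕_ ; _*_ = _⊛_ ; -_ = ZQ.-ₛ_ ; 0# = ZQ.0ₛ ; 1# = one
  ; isCommutativeRing = record
    { isRing = record
      { +-isAbelianGroup = ZQ-Ring.+-isAbelianGroup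
      ; *-cong = ⊛-cong
      ; *-assoc = ⊛-assoc
      ; *-identity = ⊛-identityˡ , (λ F → ZQ-Ring.trans (⊛-comm F one) (⊛-identityˡ F))
      ; distrib = ⊛-distribˡ , (λ F G H → ZQ-Ring.trans (⊛-comm (G ⊕ H) F)
                    (ZQ-Ring.trans (⊛-distribˡ F G H) (ZQ-Ring.+-cong {F ⊛ G} {G ⊛ F} (⊛-comm F G) (⊛-comm F H)))) }
    ; *-comm = ⊛-comm } }

open CommutativeRing PS-commutativeRing using () renaming (0# to 0ₚ)

mono≈monomial : ∀ e f → mono e f ≈ₚ ZQ.monomial e (Q.monomial f (+ 1))
mono≈monomial e f a b with a ≡ᵇ e
... | false = refl
... | true  = refl

mono-⊛ : ∀ e f F a b →
  (mono e f ⊛ F) a b ≡ (if e ≤ᵇ a then (if f ≤ᵇ b then F (a ∸ e) (b ∸ f) else + 0) else + 0)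
mono-⊛ e f F a b = begin
  (mono e f ⊛ F) a b                                       ≡⟨ ⊛-cong {G = F} (mono≈monomial e f) (λ _ _ → refl) a b ⟩
  (z^e ⊛ F) a b                                            ≡⟨ ⊛≈*ₛ z^e F a b ⟩
  (z^e ZQ.*ₛ F) a b                                        ≡⟨ ZQ.monomial-*ₛ e (Q.monomial f (+ 1)) F a b ⟩
  (if e ≤ᵇ a then Q.monomial f (+ 1) Q.*ₛ F (a ∸ e) else Q.0ₛ) b  ≡⟨ shift-q ⟩
  (if e ≤ᵇ a then (if f ≤ᵇ b then F (a ∸ e) (b ∸ f) else + 0) else + 0) ∎
  where
  open ≡.≡-Reasoning
  z^e : PS
  z^e = ZQ.monomial e (Q.monomial f (+ 1))
  shift-q : (if e ≤ᵇ a then Q.monomial f (+ 1) Q.*ₛ F (a ∸ e) else Q.0ₛ) b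
          ≡ (if e ≤ᵇ a then (if f ≤ᵇ b then F (a ∸ e) (b ∸ f) else + 0) else + 0)
  shift-q with e ≤ᵇ a
  ... | false = refl
  ... | true  with f ≤ᵇ b | Q.monomial-*ₛ f (+ 1) (F (a ∸ e)) b
  ...   | false | eq = eq
  ...   | true  | eq = ≡.trans eq (ℤ.*-identityˡ _)

mono-⊛-mono : ∀ e f e′ f′ → mono e f ⊛ mono e′ f′ ≈ₚ mono (e + e′) (f + f′)
mono-⊛-mono e f e′ f′ a b rewrite mono-⊛ e f (mono e′ f′) a b with e ≤? a | f ≤? b
... | yes e≤a | yes f≤b rewrite ≤ᵇ-true e≤a | ≤ᵇ-true f≤b | ∸-≡ᵇ e′ e≤a | ∸-≡ᵇ f′ f≤b = refl
... | yes e≤a | no  f≰b rewrite ≤ᵇ-true e≤a | ≤ᵇ-false f≰b | <⇒≡ᵇ+-false f′ (ℕ.≰⇒> f≰b)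
  with a ≡ᵇ e + e′
...   | true  = refl
...   | false = refl
mono-⊛-mono e f e′ f′ a b | no e≰a | _ rewrite ≤ᵇ-false e≰a | <⇒≡ᵇ+-false e′ (ℕ.≰⇒> e≰a) = refl

module _ where

  open CommutativeRing PS-commutativeRing
    using (reflexive; setoid; +-cong; +-congˡ; +-identityʳ; *-congˡ; *-congʳ; *-identityʳ; zeroʳ; *-comm;
           -‿cong; ring; commutativeSemiring; *-commutativeSemigroup)
    renaming (refl to ≈-refl; trans to ≈-trans)
  open import Relation.Binary.Reasoning.Setoid setoid
  open import Algebra.Properties.Ring ring using (x[y-z]≈xy-xz)
  open import Algebra.Properties.CommutativeSemigroup *-commutativeSemigroup using (interchange)
  open import Algebra.Solver.Ring.NaturalCoefficients.Default commutativeSemiring using (solve; _:+_; _:*_; _:=_)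

  geom-inverse : ∀ c → 1 ≤ c → geom c ⊛ (one ⊖ mono 0 c) ≈ₚ one
  geom-inverse c 1≤c = begin
    geom c ⊛ (one ⊖ mono 0 c)         ≈⟨ x[y-z]≈xy-xz (geom c) one (mono 0 c) ⟩
    geom c ⊛ one ⊖ geom c ⊛ mono 0 c  ≈⟨ +-cong (*-identityʳ (geom c)) (-‿cong (*-comm (geom c) (mono 0 c))) ⟩
    geom c ⊖ mono 0 c ⊛ geom c        ≈⟨ coefficients ⟩
    one                               ∎
    where
    coefficients : geom c ⊖ mono 0 c ⊛ geom c ≈ₚ one
    coefficients a b rewrite mono-⊛ 0 c (geom c) a b with a | c ≤? b
    ... | suc a | yes c≤b rewrite ≤ᵇ-true c≤b  = refl
    ... | suc a | no  c≰b rewrite ≤ᵇ-false c≰b = refl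
    ... | zero  | no  c≰b rewrite ≤ᵇ-false c≰b = below-c b (ℕ.≰⇒> c≰b)
      where
      below-c : ∀ b → b < c → (if ⌊ c ∣? b ⌋ then + 1 else + 0) ℤ.+ ℤ.- + 0 ≡ one 0 b
      below-c zero    _   with c ∣? 0
      ... | yes _   = refl
      ... | no  c∤0 = ⊥-elim (c∤0 (c ∣0))
      below-c (suc b) b<c with c ∣? suc b
      ... | yes c∣b = ⊥-elim (>⇒∤ b<c c∣b)
      ... | no  _   = refl
    ... | zero  | yes c≤b rewrite ≤ᵇ-true c≤b = above-c b c≤b
      where
      above-c : ∀ b → c ≤ b →
        (if ⌊ c ∣? b ⌋ then + 1 else + 0) ℤ.- (if ⌊ c ∣? b ∸ c ⌋ then + 1 else + 0) ≡ one 0 b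
      above-c zero    c≤0 = ⊥-elim (ℕ.<⇒≱ 1≤c c≤0)
      above-c (suc b) c≤b with c ∣? suc b | c ∣? suc b ∸ c
      ... | yes _   | yes _     = refl
      ... | no  _   | no  _     = refl
      ... | yes c∣b | no  c∤b∸c = ⊥-elim (c∤b∸c (d∣n⇒d∣n∸d c≤b c∣b))
      ... | no  c∤b | yes c∣b∸c = ⊥-elim (c∤b (∣m∸n∣n⇒∣m c c≤b c∣b∸c ∣-refl))

  geom-k-inverse : ∀ k → 1 ≤ k → ∀ n → geom (k * suc n) ⊛ (one ⊖ mono 0 (k * suc n)) ≈ₚ one
  geom-k-inverse k 1≤k n = geom-inverse (k * suc n) (ℕ.≤-trans 1≤k (ℕ.m≤m*n k (suc n)))

  poch-⊛-invPoch : ∀ k → 1 ≤ k → ∀ n → poch k n ⊛ invPoch k n ≈ₚ one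
  poch-⊛-invPoch k 1≤k zero    = *-identityʳ one
  poch-⊛-invPoch k 1≤k (suc n) = begin
    (poch k n ⊛ c) ⊛ (invPoch k n ⊛ g)  ≈⟨ interchange (poch k n) c (invPoch k n) g ⟩
    (poch k n ⊛ invPoch k n) ⊛ (c ⊛ g)  ≈⟨ ⊛-cong (poch-⊛-invPoch k 1≤k n)
                                                    (≈-trans (*-comm c g) (geom-k-inverse k 1≤k n)) ⟩
    one ⊛ one                           ≈⟨ *-identityʳ one ⟩
    one                                 ∎
    where
    c g : PS
    c = one ⊖ mono 0 (k * suc n)
    g = geom (k * suc n)

  qbinom-≤ : ∀ k {A B} → B ≤ A → qbinom k A B ≡ poch k A ⊛ invPoch k B ⊛ invPoch k (A ∸ B)
  qbinom-≤ k B≤A rewrite ≤ᵇ-true B≤A = refl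

  qbinom-> : ∀ k {A B} → A < B → qbinom k A B ≈ₚ 0ₚ
  qbinom-> k A<B rewrite ≤ᵇ-false (ℕ.<⇒≱ A<B) = ≈-refl

  qbinom-0 : ∀ k → 1 ≤ k → ∀ A → qbinom k A 0 ≈ₚ one
  qbinom-0 k 1≤k A = ≈-trans (⊛-cong (*-identityʳ (poch k A)) ≈-refl) (poch-⊛-invPoch k 1≤k A)

  qbinom-diag : ∀ k → 1 ≤ k → ∀ A → qbinom k A A ≈ₚ one
  qbinom-diag k 1≤k A rewrite qbinom-≤ k (ℕ.≤-refl {A}) | ℕ.n∸n≡0 A =
    ≈-trans (*-identityʳ _) (poch-⊛-invPoch k 1≤k A)

  -- With D = A − B − 1, cancelling the q-factorials reduces Pascal's rule to
  -- 1 − q^{k(A+1)} = (1 − q^{k(B+1)}) + q^{k(B+1)} (1 − q^{k(D+1)}).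
  qbinom-pascal-< : ∀ k → 1 ≤ k → ∀ {A B} → B < A →
    qbinom k (suc A) (suc B) ≈ₚ qbinom k A B ⊕ mono 0 (k * suc B) ⊛ qbinom k A (suc B)
  qbinom-pascal-< k 1≤k {A} {B} B<A = begin
    qbinom k (suc A) (suc B)
      ≡⟨ unfold-lhs ⟩
    P ⊛ c A ⊛ (IB ⊛ g B) ⊛ (ID ⊛ g D)
      ≈⟨ *-congʳ {ID ⊛ g D} (*-congʳ {IB ⊛ g B} (*-congˡ {P} c-A)) ⟩
    P ⊛ (c B ⊕ m ⊛ c D) ⊛ (IB ⊛ g B) ⊛ (ID ⊛ g D)
      ≈⟨ solve 8 (λ P IB ID gB gD cB cD m → P :* (cB :+ m :* cD) :* (IB :* gB) :* (ID :* gD)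
                                             := P :* IB :* ID :* (gD :* (gB :* cB) :+ m :* (gB :* (gD :* cD))))
               ≈-refl P IB ID (g B) (g D) (c B) (c D) m ⟩
    P ⊛ IB ⊛ ID ⊛ (g D ⊛ (g B ⊛ c B) ⊕ m ⊛ (g B ⊛ (g D ⊛ c D)))
      ≈⟨ *-congˡ {P ⊛ IB ⊛ ID} (+-cong (≈-trans (*-congˡ {g D} (gc B)) (*-identityʳ (g D)))
                                       (*-congˡ {m} (≈-trans (*-congˡ {g B} (gc D)) (*-identityʳ (g B))))) ⟩
    P ⊛ IB ⊛ ID ⊛ (g D ⊕ m ⊛ g B)
      ≈⟨ solve 6 (λ P IB ID gB gD m → P :* IB :* ID :* (gD :+ m :* gB)
                                       := P :* IB :* (ID :* gD) :+ m :* (P :* (IB :* gB) :* ID))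
               ≈-refl P IB ID (g B) (g D) m ⟩
    P ⊛ IB ⊛ (ID ⊛ g D) ⊕ m ⊛ (P ⊛ (IB ⊛ g B) ⊛ ID)
      ≡⟨ fold-rhs ⟩
    qbinom k A B ⊕ m ⊛ qbinom k A (suc B) ∎
    where
    D : ℕ
    D = A ∸ suc B
    P IB ID : PS
    P = poch k A
    IB = invPoch k B
    ID = invPoch k D
    c g : ℕ → PS
    c n = one ⊖ mono 0 (k * suc n)
    g n = geom (k * suc n)
    m : PS
    m = mono 0 (k * suc B)
    gc : ∀ n → g n ⊛ c n ≈ₚ one
    gc = geom-k-inverse k 1≤k
    A∸B≡1+D : A ∸ B ≡ suc D
    A∸B≡1+D = ℕ.+-∸-assoc 1 {A} {suc B} B<A
    unfold-lhs : qbinom k (suc A) (suc B) ≡ P ⊛ c A ⊛ (IB ⊛ g B) ⊛ (ID ⊛ g D)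
    unfold-lhs = ≡.trans (qbinom-≤ k (s≤s (ℕ.<⇒≤ B<A)))
                         (cong (λ n → poch k (suc A) ⊛ invPoch k (suc B) ⊛ invPoch k n) A∸B≡1+D)
    fold-rhs : P ⊛ IB ⊛ (ID ⊛ g D) ⊕ m ⊛ (P ⊛ (IB ⊛ g B) ⊛ ID) ≡ qbinom k A B ⊕ m ⊛ qbinom k A (suc B)
    fold-rhs = cong₂ (λ x y → x ⊕ m ⊛ y)
      (≡.trans (cong (λ n → P ⊛ IB ⊛ invPoch k n) (≡.sym A∸B≡1+D)) (≡.sym (qbinom-≤ k (ℕ.<⇒≤ B<A))))
      (≡.sym (qbinom-≤ k B<A))
    exponents : k * suc B + k * suc D ≡ k * suc A
    exponents = ≡.trans (≡.sym (ℕ.*-distribˡ-+ k (suc B) (suc D)))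
                        (cong (k *_) (≡.trans (ℕ.+-suc (suc B) D) (cong suc (ℕ.m+[n∸m]≡n B<A))))
    c-A : c A ≈ₚ c B ⊕ m ⊛ c D
    c-A = begin
      one ⊖ mono 0 (k * suc A)      ≈⟨ +-congˡ {one} (-‿cong (≈-trans (mono-⊛-mono 0 (k * suc B) 0 (k * suc D))
                                                                     (reflexive (cong (mono 0) exponents)))) ⟨
      one ⊖ m ⊛ mono 0 (k * suc D)  ≈⟨ 1-xy≈[1-x]+x[1-y] PS-commutativeRing m (mono 0 (k * suc D)) ⟩
      c B ⊕ m ⊛ c D                 ∎

  qbinom-pascal : ∀ k → 1 ≤ k → ∀ A B →
    qbinom k (suc A) (suc B) ≈ₚ qbinom k A B ⊕ mono 0 (k * suc B) ⊛ qbinom k A (suc B)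
  qbinom-pascal k 1≤k A B with ℕ.<-cmp B A
  ... | tri< B<A _ _ = qbinom-pascal-< k 1≤k B<A
  ... | tri≈ _ refl _ = begin
    qbinom k (suc A) (suc A)                                ≈⟨ qbinom-diag k 1≤k (suc A) ⟩
    one                                                     ≈⟨ +-identityʳ one ⟨
    one ⊕ 0ₚ                                                ≈⟨ +-cong (qbinom-diag k 1≤k A) (vanishing (ℕ.n<1+n A)) ⟨
    qbinom k A A ⊕ mono 0 (k * suc A) ⊛ qbinom k A (suc A)  ∎
    where
    vanishing : ∀ {C} → A < C → mono 0 (k * suc A) ⊛ qbinom k A C ≈ₚ 0ₚ
    vanishing A<C = ≈-trans (*-congˡ {mono 0 (k * suc A)} (qbinom-> k A<C)) (zeroʳ (mono 0 (k * suc A)))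
  ... | tri> _ _ A<B = begin
    qbinom k (suc A) (suc B)                                ≈⟨ qbinom-> k (s≤s A<B) ⟩
    0ₚ                                                      ≈⟨ +-identityʳ 0ₚ ⟨
    0ₚ ⊕ 0ₚ                                                 ≈⟨ +-cong (qbinom-> k A<B) vanishing ⟨
    qbinom k A B ⊕ mono 0 (k * suc B) ⊛ qbinom k A (suc B)  ∎
    where
    vanishing : mono 0 (k * suc B) ⊛ qbinom k A (suc B) ≈ₚ 0ₚ
    vanishing = ≈-trans (*-congˡ {mono 0 (k * suc B)} (qbinom-> k (ℕ.m<n⇒m<1+n A<B))) (zeroʳ (mono 0 (k * suc B)))

open FiniteSum ℕ.+-0-commutativeMonoid

count : ∀ {A : Set} → (A → Bool) → List A → ℕ
count P []       = 0
count P (x ∷ xs) = if P x then suc (count P xs) else count P xs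

module _ {A : Set} where

  length-filterᵇ : ∀ (P : A → Bool) xs → length (filterᵇ P xs) ≡ count P xs
  length-filterᵇ P []       = refl
  length-filterᵇ P (x ∷ xs) with P x
  ... | true  = cong suc (length-filterᵇ P xs)
  ... | false = length-filterᵇ P xs

  count-++ : ∀ (P : A → Bool) xs ys → count P (xs ++ ys) ≡ count P xs + count P ys
  count-++ P []       ys = refl
  count-++ P (x ∷ xs) ys with P x
  ... | true  = cong suc (count-++ P xs ys)
  ... | false = count-++ P xs ys

  count-map : ∀ {B : Set} (P : B → Bool) (f : A → B) xs → count P (map f xs) ≡ count (P ∘ f) xs
  count-map P f []       = refl
  count-map P f (x ∷ xs) with P (f x)
  ... | true  = cong suc (count-map P f xs)
  ... | false = count-map P f xs

  count-cong : ∀ {P Q : A → Bool} {xs} → All (λ x → P x ≡ Q x) xs → count P xs ≡ count Q xs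
  count-cong {xs = []}     []            = refl
  count-cong {Q = Q} {x ∷ xs} (Px≡Qx ∷ eqs) rewrite Px≡Qx with Q x
  ... | true  = cong suc (count-cong eqs)
  ... | false = count-cong eqs

  count-none : ∀ {P : A → Bool} xs → (∀ x → P x ≡ false) → count P xs ≡ 0
  count-none []       _        = refl
  count-none (x ∷ xs) Px≡false rewrite Px≡false x = count-none xs Px≡false

  count-split : ∀ (P Q : A → Bool) xs →
    count P xs ≡ count (λ x → P x ∧ not (Q x)) xs + count (λ x → P x ∧ Q x) xs
  count-split P Q []       = refl
  count-split P Q (x ∷ xs) with P x | Q x
  ... | false | _     = count-split P Q xs
  ... | true  | false = cong suc (count-split P Q xs)
  ... | true  | true  = ≡.trans (cong suc (count-split P Q xs)) (≡.sym (ℕ.+-suc _ _))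

  count-if : ∀ c (P : A → Bool) xs → count (λ x → c ∧ P x) xs ≡ (if c then count P xs else 0)
  count-if true  P xs = refl
  count-if false P xs = count-none xs (λ _ → refl)

listsOf-length : ∀ n B → All (λ l → length l ≡ n) (listsOf n B)
listsOf-length zero    B = refl ∷ []
listsOf-length (suc n) B =
  concat⁺ (map⁺ (All.universal (λ p → map⁺ (All.map (cong suc) (listsOf-length n B))) (partsUpTo B)))

countHead : (List Part → Bool) → ℕ → ℕ → ℕ → ℕ
countHead P n B t = count (P ∘ ((suc t , false) ∷_)) (listsOf n B) + count (P ∘ ((suc t , true) ∷_)) (listsOf n B)

count-listsOf-suc : ∀ P n B → count P (listsOf (suc n) B) ≡ ∑ B (countHead P n B)
count-listsOf-suc P n B = go (λ t → t) B
  where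
  open ≡.≡-Reasoning
  extend : Part → List (List Part)
  extend p = map (p ∷_) (listsOf n B)
  pair : ℕ → List Part
  pair t = (suc t , false) ∷ (suc t , true) ∷ []
  count-pair : ∀ t → count P (concatMap extend (pair t)) ≡ countHead P n B t
  count-pair t = begin
    count P (extend (suc t , false) ++ (extend (suc t , true) ++ []))
      ≡⟨ count-++ P (extend (suc t , false)) _ ⟩
    count P (extend (suc t , false)) + count P (extend (suc t , true) ++ [])
      ≡⟨ cong₂ _+_ (count-map P _ (listsOf n B))
                   (≡.trans (count-++ P (extend (suc t , true)) [])
                            (≡.trans (ℕ.+-identityʳ _) (count-map P _ (listsOf n B)))) ⟩
    countHead P n B t ∎
  go : ∀ f m → count P (concatMap extend (concatMap pair (applyUpTo f m))) ≡ ∑ m (countHead P n B ∘ f)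
  go f zero    = refl
  go f (suc m) = begin
    count P (concatMap extend (pair (f 0) ++ concatMap pair (applyUpTo (f ∘ suc) m)))
      ≡⟨ cong (count P) (concatMap-++ extend (pair (f 0)) (concatMap pair (applyUpTo (f ∘ suc) m))) ⟩
    count P (concatMap extend (pair (f 0)) ++ concatMap extend (concatMap pair (applyUpTo (f ∘ suc) m)))
      ≡⟨ count-++ P (concatMap extend (pair (f 0))) _ ⟩
    count P (concatMap extend (pair (f 0))) + count P (concatMap extend (concatMap pair (applyUpTo (f ∘ suc) m)))
      ≡⟨ cong₂ _+_ (count-pair (f 0)) (go (f ∘ suc) m) ⟩
    ∑ (suc m) (countHead P n B ∘ f) ∎

Bounded : ℕ → (List Part → Bool) → Set
Bounded W P = ∀ l → P l ≡ true → All (λ p → size p ≤ W) l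

-- GL enumerates its candidates with the weight as bound on the part sizes; this lemma lets the
-- bound follow the weight when a part is removed.
count-listsOf-bound : ∀ n {W B} P → Bounded W P → W ≤ B → count P (listsOf n B) ≡ count P (listsOf n W)
count-listsOf-bound zero    P bounded W≤B = refl
count-listsOf-bound (suc n) {W} {B} P bounded W≤B = begin
  count P (listsOf (suc n) B)
    ≡⟨ count-listsOf-suc P n B ⟩
  ∑ B (countHead P n B)
    ≡⟨ cong (λ m → ∑ m (countHead P n B)) (ℕ.m+[n∸m]≡n W≤B) ⟨
  ∑ (W + (B ∸ W)) (countHead P n B)
    ≡⟨ ∑-split W (B ∸ W) (countHead P n B) ⟩
  ∑ W (countHead P n B) + ∑ (B ∸ W) (λ i → countHead P n B (W + i))
    ≡⟨ cong₂ _+_ (∑-cong W (λ t → cong₂ _+_ tail tail)) (∑-ε (B ∸ W) (λ i _ → cong₂ _+_ (too-big i) (too-big i))) ⟩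
  ∑ W (countHead P n W) + 0
    ≡⟨ ℕ.+-identityʳ _ ⟩
  ∑ W (countHead P n W)
    ≡⟨ count-listsOf-suc P n W ⟨
  count P (listsOf (suc n) W) ∎
  where
  open ≡.≡-Reasoning
  tail : ∀ {t o} → count (P ∘ ((suc t , o) ∷_)) (listsOf n B) ≡ count (P ∘ ((suc t , o) ∷_)) (listsOf n W)
  tail {t} {o} = count-listsOf-bound n (P ∘ ((suc t , o) ∷_)) (λ l Pl → All.tail (bounded _ Pl)) W≤B
  too-big : ∀ i {o} → count (P ∘ ((suc (W + i) , o) ∷_)) (listsOf n B) ≡ 0
  too-big i {o} = count-none (listsOf n B) heavy
    where
    heavy : ∀ l → P ((suc (W + i) , o) ∷ l) ≡ false
    heavy l with P ((suc (W + i) , o) ∷ l) in Pl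
    ... | false = refl
    ... | true  = ⊥-elim (ℕ.<⇒≱ (s≤s (ℕ.m≤m+n W i)) (All.head (bounded _ Pl)))

open ∧-Solver using (_⊜_) renaming (solve to solve-∧; _⊕_ to _&_)

linked : ℕ → Part → Part → ℕ → Bool
linked k p q len =
  (1 ≤ᵇ size p) ∧ ((size q ≤ᵇ size p) ∧ ((if over p then size q <ᵇ size p else true) ∧
  ((not (over p) ∨ ⌊ k ∣? len ⌋) ∧ ((size p ≤ᵇ size q + 1) ∧ (if over p then true else size p <ᵇ size q + 1)))))

isBL-∷ : ∀ k m p q r → isBL k (suc m) (p ∷ q ∷ r) ≡ linked k p q (length (q ∷ r)) ∧ isBL k m (q ∷ r)
isBL-∷ k m p q r = solve-∧ 12 (λ pos pos′ le lt ch dv lk len last le′ lt′ bl →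
    ((pos & pos′) & (le & (lt & ch))) & ((dv & lk) & (len & (last & (le′ & (lt′ & bl)))))
  ⊜ (pos & (le & (lt & (dv & (le′ & lt′))))) & ((pos′ & ch) & (lk & (len & (last & bl))))) refl
  (1 ≤ᵇ size p) (allPositive (q ∷ r)) (size q ≤ᵇ size p) (if over p then size q <ᵇ size p else true)
  (overChain (q ∷ r)) (not (over p) ∨ ⌊ k ∣? length (q ∷ r) ⌋) (isLk k (q ∷ r)) (length (q ∷ r) ≡ᵇ m)
  (lastIsOne (q ∷ r)) (size p ≤ᵇ size q + 1) (if over p then true else size p <ᵇ size q + 1) (blChain (q ∷ r))

linked-plain : ∀ k {j} s o len → 1 ≤ j → linked k (j , false) (s , o) len ≡ (s ≡ᵇ j)
linked-plain k {suc i} s o len _ rewrite ℕ.+-comm s 1 with ℕ.<-cmp s (suc i)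
... | tri< s<j s≢j _ rewrite ≤ᵇ-true (ℕ.<⇒≤ s<j) | ≤ᵇ-false (ℕ.<⇒≱ s<j) | ≡ᵇ-false s≢j = ∧-zeroʳ _
... | tri≈ _ refl _  rewrite ≤ᵇ-true (ℕ.≤-refl {s}) | ≤ᵇ-true (ℕ.n≤1+n s) | ≡ᵇ-true (refl {x = i}) = refl
... | tri> _ s≢j j<s rewrite ≤ᵇ-false (ℕ.<⇒≱ j<s) | ≡ᵇ-false s≢j = refl

linked-over : ∀ k {j} s o len → 1 ≤ j → linked k (j , true) (s , o) len ≡ ⌊ k ∣? len ⌋ ∧ (s ≡ᵇ j ∸ 1)
linked-over k {suc i} s o len _ rewrite ℕ.+-comm s 1 with ℕ.<-cmp s i
... | tri< s<i s≢i _ rewrite ≤ᵇ-true (ℕ.m≤n⇒m≤1+n (ℕ.<⇒≤ s<i)) | ≤ᵇ-true (ℕ.m<n⇒m<1+n s<i)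
                           | ≤ᵇ-false (ℕ.<⇒≱ (s≤s s<i)) | ≡ᵇ-false s≢i = refl
... | tri≈ _ refl _  rewrite ≤ᵇ-true (ℕ.n≤1+n s) | ≤ᵇ-true (ℕ.n<1+n s) | ≡ᵇ-true (refl {x = s}) = refl
... | tri> _ s≢i i<s rewrite ≤ᵇ-false (ℕ.<⇒≱ (s≤s i<s)) | ≡ᵇ-false s≢i =
  ≡.trans (∧-zeroʳ (s ≤ᵇ suc i)) (≡.sym (∧-zeroʳ ⌊ k ∣? len ⌋))

hasLargest : ℕ → List Part → Bool
hasLargest j []      = false
hasLargest j (p ∷ _) = size p ≡ᵇ j

inBL : ℕ → ℕ → ℕ → ℕ → ℕ → List Part → Bool
inBL k n j a b l = hasLargest j l ∧ (isBL k n l ∧ ((numOver l ≡ᵇ a) ∧ (weight l ≡ᵇ b)))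

inBL-plain-head : ∀ k n {j a b} → 1 ≤ j → j ≤ b → ∀ r → length r ≡ suc n →
  inBL k (suc (suc n)) j a b ((j , false) ∷ r) ≡ inBL k (suc n) j a (b ∸ j) r
inBL-plain-head k n {j} {a} {b} 1≤j j≤b ((s , o) ∷ r) _
  rewrite ≡ᵇ-true (refl {x = j}) | isBL-∷ k (suc n) (j , false) (s , o) r
        | linked-plain k s o (length ((s , o) ∷ r)) 1≤j | +-≡ᵇ (weight ((s , o) ∷ r)) j≤b
  = ∧-assoc (s ≡ᵇ j) _ _

inBL-over-head : ∀ k n {j a b} → 1 ≤ j → j ≤ b → ∀ r → length r ≡ suc n →
  inBL k (suc (suc n)) j a b ((j , true) ∷ r)
    ≡ (⌊ k ∣? suc n ⌋ ∧ (1 ≤ᵇ a)) ∧ inBL k (suc n) (j ∸ 1) (a ∸ 1) (b ∸ j) r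
inBL-over-head k n {j} {a} {b} 1≤j j≤b ((s , o) ∷ r) len≡1+n
  rewrite ≡ᵇ-true (refl {x = j}) | isBL-∷ k (suc n) (j , true) (s , o) r
        | linked-over k s o (length ((s , o) ∷ r)) 1≤j | len≡1+n
        | suc-≡ᵇ (numOver ((s , o) ∷ r)) a | +-≡ᵇ (weight ((s , o) ∷ r)) j≤b
  = solve-∧ 6 (λ dv sz bl pos no wt → ((dv & sz) & bl) & ((pos & no) & wt) ⊜ (dv & pos) & (sz & (bl & (no & wt))))
      refl ⌊ k ∣? suc n ⌋ (s ≡ᵇ j ∸ 1) (isBL k (suc n) ((s , o) ∷ r)) (1 ≤ᵇ a)
           (numOver ((s , o) ∷ r) ≡ᵇ a ∸ 1) (weight ((s , o) ∷ r) ≡ᵇ b ∸ j)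

size≤weight : ∀ l → All (λ p → size p ≤ weight l) l
size≤weight []      = []
size≤weight (p ∷ l) =
  ℕ.m≤m+n (size p) (weight l) ∷ All.map (λ le → ℕ.≤-trans le (ℕ.m≤n+m _ (size p))) (size≤weight l)

inBL-bounded : ∀ k n j a w → Bounded w (inBL k n j a w)
inBL-bounded k n j a w l inBL≡true = ≡.subst (λ x → All (λ p → size p ≤ x) l) weight≡w (size≤weight l)
  where
  weight≡w : weight l ≡ w
  weight≡w = ℕ.≡ᵇ⇒≡ (weight l) w (Equivalence.from T-≡
    (∧-conicalʳ (numOver l ≡ᵇ a) _ (∧-conicalʳ (isBL k n l) _ (∧-conicalʳ (hasLargest j l) _ inBL≡true))))

countBL : ℕ → ℕ → ℕ → ℕ → ℕ → ℕ
countBL k n j a b = count (inBL k n j a b) (listsOf n b)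

countBL-large-part : ∀ k n {j a b} → b < j → countBL k (suc n) j a b ≡ 0
countBL-large-part k n {j} {a} {b} b<j = ≡.trans (count-listsOf-suc (inBL k (suc n) j a b) n b)
  (∑-ε b (λ t t<b → cong₂ _+_ (count-none (listsOf n b) (wrong-head {o = false} t<b))
                              (count-none (listsOf n b) (wrong-head {o = true} t<b))))
  where
  wrong-head : ∀ {t o} → t < b → ∀ r → inBL k (suc n) j a b ((suc t , o) ∷ r) ≡ false
  wrong-head {t} t<b r rewrite ≡ᵇ-false {suc t} {j} (λ { refl → ℕ.<⇒≱ t<b (ℕ.≤-pred b<j) }) = refl

countBL-first-part : ∀ k n {i a b} → i < b → countBL k (suc n) (suc i) a b
  ≡ count (inBL k (suc n) (suc i) a b ∘ ((suc i , false) ∷_)) (listsOf n b)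
    + count (inBL k (suc n) (suc i) a b ∘ ((suc i , true) ∷_)) (listsOf n b)
countBL-first-part k n {i} {a} {b} i<b = ≡.trans (count-listsOf-suc (inBL k (suc n) (suc i) a b) n b)
  (∑-single b i i<b (λ t t≢i → cong₂ _+_ (count-none (listsOf n b) (wrong-head {o = false} t≢i))
                                         (count-none (listsOf n b) (wrong-head {o = true} t≢i))))
  where
  wrong-head : ∀ {t o} → t ≢ i → ∀ r → inBL k (suc n) (suc i) a b ((suc t , o) ∷ r) ≡ false
  wrong-head {t} t≢i r rewrite ≡ᵇ-false {suc t} {suc i} (t≢i ∘ ℕ.suc-injective) = refl

countBL-suc : ∀ k n {j a b} → 1 ≤ j → j ≤ b →
  countBL k (suc (suc n)) j a b
    ≡ countBL k (suc n) j a (b ∸ j)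
      + (if ⌊ k ∣? suc n ⌋ ∧ (1 ≤ᵇ a) then countBL k (suc n) (j ∸ 1) (a ∸ 1) (b ∸ j) else 0)
countBL-suc k n {j@(suc i)} {a} {b} 1≤j j≤b =
  ≡.trans (countBL-first-part k (suc n) j≤b) (cong₂ _+_ plain-head over-head)
  where
  tails : List (List Part)
  tails = listsOf (suc n) b
  D : Bool
  D = ⌊ k ∣? suc n ⌋ ∧ (1 ≤ᵇ a)
  lower-bound : ∀ {j′ a′} → count (inBL k (suc n) j′ a′ (b ∸ j)) tails ≡ countBL k (suc n) j′ a′ (b ∸ j)
  lower-bound {j′} {a′} =
    count-listsOf-bound (suc n) (inBL k (suc n) j′ a′ (b ∸ j)) (inBL-bounded k (suc n) j′ a′ (b ∸ j)) (ℕ.m∸n≤m b j)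
  plain-head : count (inBL k (suc (suc n)) j a b ∘ ((j , false) ∷_)) tails ≡ countBL k (suc n) j a (b ∸ j)
  plain-head = ≡.trans
    (count-cong (All.map (λ {r} → inBL-plain-head k n {a = a} 1≤j j≤b r) (listsOf-length (suc n) b)))
    lower-bound
  over-head : count (inBL k (suc (suc n)) j a b ∘ ((j , true) ∷_)) tails
            ≡ (if D then countBL k (suc n) i (a ∸ 1) (b ∸ j) else 0)
  over-head = ≡.trans
    (count-cong (All.map (λ {r} → inBL-over-head k n {a = a} 1≤j j≤b r) (listsOf-length (suc n) b)))
    (≡.trans (count-if D (inBL k (suc n) i (a ∸ 1) (b ∸ j)) tails) (cong (if D then_else 0) lower-bound))

GLsum : ℕ → ℕ → ℕ → PS
GLsum k n j = GL k n j false ⊕ GL k n j true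

overlinedFirst : List Part → Bool
overlinedFirst []      = false
overlinedFirst (p ∷ _) = over p

GL-predicate : ∀ k n j o a b l →
  isBL k n l ∧ (largestIs j o l ∧ ((numOver l ≡ᵇ a) ∧ (weight l ≡ᵇ b)))
    ≡ inBL k n j a b l ∧ (if o then overlinedFirst l else not (overlinedFirst l))
GL-predicate k n j o a b []             = ∧-zeroʳ (isBL k n [])
GL-predicate k n j o a b ((t , o′) ∷ r) =
  solve-∧ 5 (λ bl lg ov no wt → bl & ((lg & ov) & (no & wt)) ⊜ (lg & (bl & (no & wt))) & ov) refl
    (isBL k n ((t , o′) ∷ r)) (t ≡ᵇ j) (if o then o′ else not o′)
    (numOver ((t , o′) ∷ r) ≡ᵇ a) (weight ((t , o′) ∷ r) ≡ᵇ b)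

GLsum-coeff : ∀ k n j a b → GLsum k n j a b ≡ + countBL k n j a b
GLsum-coeff k n j a b = cong +_ (≡.trans (cong₂ _+_ (GL-count false) (GL-count true))
                                         (≡.sym (count-split (inBL k n j a b) overlinedFirst (listsOf n b))))
  where
  GL-count : ∀ o → length (filterᵇ _ (listsOf n b))
               ≡ count (λ l → inBL k n j a b l ∧ (if o then overlinedFirst l else not (overlinedFirst l))) (listsOf n b)
  GL-count o = ≡.trans (length-filterᵇ _ (listsOf n b)) (count-cong (All.universal (GL-predicate k n j o a b) (listsOf n b)))

GLsum-suc-coeff : ∀ k n {j} → 1 ≤ j → ∀ a b →
  GLsum k (suc (suc n)) j a b
    ≡ (mono 0 j ⊛ GLsum k (suc n) j) a b
      ℤ.+ (if ⌊ k ∣? suc n ⌋ then (mono 1 j ⊛ GLsum k (suc n) (j ∸ 1)) a b else + 0)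
GLsum-suc-coeff k n {j} 1≤j a b
  rewrite GLsum-coeff k (suc (suc n)) j a b
        | mono-⊛ 0 j (GLsum k (suc n) j) a b | mono-⊛ 1 j (GLsum k (suc n) (j ∸ 1)) a b
  with j ≤? b
... | yes j≤b rewrite ≤ᵇ-true j≤b | countBL-suc k n {a = a} 1≤j j≤b
                    | GLsum-coeff k (suc n) j a (b ∸ j) | GLsum-coeff k (suc n) (j ∸ 1) (a ∸ 1) (b ∸ j)
  with ⌊ k ∣? suc n ⌋ | a
...   | false | _     = refl
...   | true  | zero  = refl
...   | true  | suc _ = refl
GLsum-suc-coeff k n {j} 1≤j a b | no j≰b rewrite ≤ᵇ-false j≰b | countBL-large-part k (suc n) {a = a} (ℕ.≰⇒> j≰b)
  with ⌊ k ∣? suc n ⌋ | a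
...   | false | _     = refl
...   | true  | zero  = refl
...   | true  | suc _ = refl

GLsum-suc-∤ : ∀ k n {j} → 1 ≤ j → ¬ k ∣ suc n → GLsum k (suc (suc n)) j ≈ₚ mono 0 j ⊛ GLsum k (suc n) j
GLsum-suc-∤ k n 1≤j k∤ a b rewrite GLsum-suc-coeff k n 1≤j a b with k ∣? suc n
... | yes k∣ = ⊥-elim (k∤ k∣)
... | no  _  = ℤ.+-identityʳ _

GLsum-suc-∣ : ∀ k n {j} → 1 ≤ j → k ∣ suc n →
  GLsum k (suc (suc n)) j ≈ₚ mono 0 j ⊛ GLsum k (suc n) j ⊕ mono 1 j ⊛ GLsum k (suc n) (j ∸ 1)
GLsum-suc-∣ k n 1≤j k∣ a b rewrite GLsum-suc-coeff k n 1≤j a b with k ∣? suc n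
... | yes _  = refl
... | no  k∤ = ⊥-elim (k∤ k∣)

GLsum-largest-0 : ∀ k n → GLsum k n 0 ≈ₚ 0ₚ
GLsum-largest-0 k n a b = ≡.trans (GLsum-coeff k n 0 a b) (cong +_ (count-none (listsOf n b) no-list))
  where
  no-list : ∀ l → inBL k n 0 a b l ≡ false
  no-list []                = refl
  no-list ((zero  , _) ∷ _) = refl
  no-list ((suc _ , _) ∷ _) = refl

GLsum-1-1 : ∀ k → GLsum k 1 1 ≈ₚ mono 0 1 ⊕ mono 1 1
GLsum-1-1 k a zero rewrite GLsum-coeff k 1 1 a 0 | countBL-large-part k 0 {1} {a} (s≤s z≤n) with a
... | zero        = refl
... | suc zero    = refl
... | suc (suc _) = refl
GLsum-1-1 k a (suc b) = ≡.trans (GLsum-coeff k 1 1 a (suc b))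
  (≡.trans (cong +_ (countBL-first-part k 0 {0} {a} {suc b} (s≤s z≤n))) (singletons a b))
  where
  singletons : ∀ a b → + (count (inBL k 1 1 a (suc b) ∘ ((1 , false) ∷_)) (listsOf 0 (suc b))
                          + count (inBL k 1 1 a (suc b) ∘ ((1 , true) ∷_)) (listsOf 0 (suc b)))
                       ≡ (mono 0 1 ⊕ mono 1 1) a (suc b)
  singletons a b rewrite k∣?0 k with a | b
  ... | zero        | zero  = refl
  ... | zero        | suc _ = refl
  ... | suc zero    | zero  = refl
  ... | suc zero    | suc _ = refl
  ... | suc (suc _) | zero  = refl
  ... | suc (suc _) | suc _ = refl

GLsum-1-2+ : ∀ k i → GLsum k 1 (suc (suc i)) ≈ₚ 0ₚ
GLsum-1-2+ k i a b with suc i ℕ.<? b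
... | yes i<b = ≡.trans (GLsum-coeff k 1 j a b) (cong +_ (≡.trans (countBL-first-part k 0 {suc i} {a} i<b) not-last))
  where
  j = suc (suc i)
  not-last : count (inBL k 1 j a b ∘ ((j , false) ∷_)) (listsOf 0 b)
             + count (inBL k 1 j a b ∘ ((j , true) ∷_)) (listsOf 0 b) ≡ 0
  not-last rewrite k∣?0 k | ≡ᵇ-true (refl {x = i}) = refl
... | no  i≮b = ≡.trans (GLsum-coeff k 1 (suc (suc i)) a b)
                        (cong +_ (countBL-large-part k 0 {suc (suc i)} {a} (s≤s (ℕ.≮⇒≥ i≮b))))

exponent : ℕ → ℕ → ℕ → ℕ → ℕ
exponent k s m j = k * (j C 2) + s * j + k * (m ∸ j)

zPart : ℕ → PS
zPart j = mono (j ∸ 1) 0 ⊕ mono j 0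

closedForm : ℕ → ℕ → ℕ → ℕ → PS
closedForm k s m j = zPart j ⊛ mono 0 (exponent k s m j) ⊛ qbinom k (m ∸ 1) (j ∸ 1)

exponent-s-step : ∀ k s m j → exponent k s m j + j ≡ exponent k (suc s) m j
exponent-s-step k s m j = identity k (j C 2) s j (m ∸ j)
  where
  identity : ∀ k c s j d → k * c + s * j + k * d + j ≡ k * c + suc s * j + k * d
  identity = solve-∀

exponent-m-step-1 : ∀ k m → exponent k k (suc m) 1 + 1 ≡ exponent k 1 (suc (suc m)) 1
exponent-m-step-1 k m = identity k m
  where
  identity : ∀ k m → k * 0 + k * 1 + k * m + 1 ≡ k * 0 + 1 * 1 + k * suc m
  identity = solve-∀

[2+i]C2≡[1+i]C2+[1+i] : ∀ i → suc (suc i) C 2 ≡ suc i C 2 + suc i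
[2+i]C2≡[1+i]C2+[1+i] i =
  ≡.trans (≡.sym (nCk+nC[k+1]≡[n+1]C[k+1] (suc i) 1)) (≡.trans (cong (_+ (suc i C 2)) (nC1≡n (suc i))) (ℕ.+-comm (suc i) _))

exponent-m-step-over : ∀ k m i → exponent k k m (suc i) + suc (suc i) ≡ exponent k 1 (suc m) (suc (suc i))
exponent-m-step-over k m i rewrite [2+i]C2≡[1+i]C2+[1+i] i = identity k i (suc i C 2) (m ∸ suc i)
  where
  identity : ∀ k i c d → k * c + k * suc i + k * d + suc (suc i) ≡ k * (c + suc i) + 1 * suc (suc i) + k * d
  identity = solve-∀

exponent-m-step-plain : ∀ k m i → suc i ≤ m →
  exponent k k (suc m) (suc (suc i)) + suc (suc i) ≡ exponent k 1 (suc (suc m)) (suc (suc i)) + k * suc i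
exponent-m-step-plain k m i i<m rewrite ℕ.+-∸-assoc 1 {m} {suc i} i<m = identity k i (suc (suc i) C 2) (m ∸ suc i)
  where
  identity : ∀ k i c d →
    k * c + k * suc (suc i) + k * d + suc (suc i) ≡ k * c + 1 * suc (suc i) + k * suc d + k * suc i
  identity = solve-∀

k*[1+m]+1≡1+k*m+k : ∀ k m → k * suc m + 1 ≡ suc (k * m + k)
k*[1+m]+1≡1+k*m+k = solve-∀

module _ where

  open CommutativeRing PS-commutativeRing
    using (reflexive; setoid; +-cong; +-congˡ; +-identityʳ; +-comm; *-congˡ; *-congʳ; *-identityʳ; zeroʳ;
           distribˡ; distribʳ; commutativeSemiring)
    renaming (refl to ≈-refl; sym to ≈-sym; trans to ≈-trans)
  open import Relation.Binary.Reasoning.Setoid setoid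
  open import Algebra.Solver.Ring.NaturalCoefficients.Default commutativeSemiring using (solve; _:*_; _:=_)

  absorb-q^ : ∀ X e d Q → mono 0 d ⊛ (X ⊛ mono 0 e ⊛ Q) ≈ₚ X ⊛ mono 0 (e + d) ⊛ Q
  absorb-q^ X e d Q =
    ≈-trans (solve 4 (λ d X e Q → d :* (X :* e :* Q) := X :* (e :* d) :* Q) ≈-refl (mono 0 d) X (mono 0 e) Q)
            (*-congʳ {Q} (*-congˡ {X} (mono-⊛-mono 0 e 0 d)))

  z⊛zPart : ∀ i → mono 1 0 ⊛ zPart (suc i) ≈ₚ zPart (suc (suc i))
  z⊛zPart i = ≈-trans (distribˡ (mono 1 0) (mono i 0) (mono (suc i) 0))
                      (+-cong {mono 1 0 ⊛ mono i 0} (mono-⊛-mono 1 0 i 0) (mono-⊛-mono 1 0 (suc i) 0))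

  closedForm-1 : ∀ k → 1 ≤ k → ∀ j → 1 ≤ j → GLsum k 1 j ≈ₚ closedForm k 1 1 j
  closedForm-1 k 1≤k (suc zero) _ = begin
    GLsum k 1 1                                ≈⟨ GLsum-1-1 k ⟩
    mono 0 1 ⊕ mono 1 1                        ≈⟨ +-cong (mono-⊛-mono 0 0 0 1) (mono-⊛-mono 1 0 0 1) ⟨
    mono 0 0 ⊛ mono 0 1 ⊕ mono 1 0 ⊛ mono 0 1  ≈⟨ distribʳ (mono 0 1) (mono 0 0) (mono 1 0) ⟨
    zPart 1 ⊛ mono 0 1                         ≡⟨ cong (λ e → zPart 1 ⊛ mono 0 e) (≡.sym exponent≡1) ⟩
    X                                          ≈⟨ ≈-trans (*-congˡ {X} (qbinom-0 k 1≤k 0)) (*-identityʳ X) ⟨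
    closedForm k 1 1 1                         ∎
    where
    X : PS
    X = zPart 1 ⊛ mono 0 (exponent k 1 1 1)
    exponent≡1 : exponent k 1 1 1 ≡ 1
    exponent≡1 rewrite ℕ.*-zeroʳ k = refl
  closedForm-1 k 1≤k (suc (suc i)) _ = begin
    GLsum k 1 (suc (suc i))                    ≈⟨ GLsum-1-2+ k i ⟩
    0ₚ                                         ≈⟨ zeroʳ X ⟨
    X ⊛ 0ₚ                                     ≈⟨ *-congˡ {X} (qbinom-> k {0} {suc i} (s≤s z≤n)) ⟨
    closedForm k 1 1 (suc (suc i))             ∎
    where
    X : PS
    X = zPart (suc (suc i)) ⊛ mono 0 (exponent k 1 1 (suc (suc i)))

  closedForm-s-step : ∀ k s m {N j} → 1 ≤ N → 1 ≤ j → ¬ k ∣ N →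
    GLsum k N j ≈ₚ closedForm k s m j → GLsum k (suc N) j ≈ₚ closedForm k (suc s) m j
  closedForm-s-step k s m {suc n} {j} _ 1≤j k∤N GL≈ = begin
    GLsum k (suc (suc n)) j                      ≈⟨ GLsum-suc-∤ k n 1≤j k∤N ⟩
    mono 0 j ⊛ GLsum k (suc n) j                 ≈⟨ *-congˡ {mono 0 j} GL≈ ⟩
    mono 0 j ⊛ closedForm k s m j                ≈⟨ absorb-q^ (zPart j) (exponent k s m j) j Q ⟩
    zPart j ⊛ mono 0 (exponent k s m j + j) ⊛ Q  ≡⟨ cong (λ e → zPart j ⊛ mono 0 e ⊛ Q) (exponent-s-step k s m j) ⟩
    closedForm k (suc s) m j                     ∎
    where
    Q : PS
    Q = qbinom k (m ∸ 1) (j ∸ 1)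

  closedForm-m-step-over : ∀ k m i →
    mono 1 (suc (suc i)) ⊛ closedForm k k (suc m) (suc i)
      ≈ₚ zPart (suc (suc i)) ⊛ mono 0 (exponent k 1 (suc (suc m)) (suc (suc i))) ⊛ qbinom k m i
  closedForm-m-step-over k m i = begin
    mono 1 j ⊛ (zPart (suc i) ⊛ mono 0 E ⊛ qbinom k m i)
      ≈⟨ *-congʳ {zPart (suc i) ⊛ mono 0 E ⊛ qbinom k m i} (mono-⊛-mono 1 0 0 j) ⟨
    mono 1 0 ⊛ mono 0 j ⊛ (zPart (suc i) ⊛ mono 0 E ⊛ qbinom k m i)
      ≈⟨ solve 5 (λ z q X e Q → z :* q :* (X :* e :* Q) := z :* X :* (e :* q) :* Q) ≈-refl
           (mono 1 0) (mono 0 j) (zPart (suc i)) (mono 0 E) (qbinom k m i) ⟩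
    mono 1 0 ⊛ zPart (suc i) ⊛ (mono 0 E ⊛ mono 0 j) ⊛ qbinom k m i
      ≈⟨ *-congʳ {qbinom k m i} (⊛-cong (z⊛zPart i)
           (≈-trans (mono-⊛-mono 0 E 0 j) (reflexive (cong (mono 0) (exponent-m-step-over k (suc m) i))))) ⟩
    zPart j ⊛ mono 0 (exponent k 1 (suc (suc m)) j) ⊛ qbinom k m i ∎
    where
    j E : ℕ
    j = suc (suc i)
    E = exponent k k (suc m) (suc i)

  closedForm-m-step-plain : ∀ k m i →
    mono 0 (suc (suc i)) ⊛ closedForm k k (suc m) (suc (suc i))
      ≈ₚ zPart (suc (suc i)) ⊛ mono 0 (exponent k 1 (suc (suc m)) (suc (suc i))) ⊛ (mono 0 (k * suc i) ⊛ qbinom k m (suc i))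
  closedForm-m-step-plain k m i with suc i ℕ.≤? m
  ... | yes i<m = begin
    mono 0 j ⊛ closedForm k k (suc m) j
      ≈⟨ absorb-q^ (zPart j) (exponent k k (suc m) j) j Q ⟩
    zPart j ⊛ mono 0 (exponent k k (suc m) j + j) ⊛ Q
      ≡⟨ cong (λ e → zPart j ⊛ mono 0 e ⊛ Q) (exponent-m-step-plain k m i i<m) ⟩
    zPart j ⊛ mono 0 (E + k * suc i) ⊛ Q
      ≈⟨ *-congʳ {Q} (*-congˡ {zPart j} (mono-⊛-mono 0 E 0 (k * suc i))) ⟨
    zPart j ⊛ (mono 0 E ⊛ mono 0 (k * suc i)) ⊛ Q
      ≈⟨ solve 4 (λ X e d Q → X :* (e :* d) :* Q := X :* e :* (d :* Q)) ≈-refl (zPart j) (mono 0 E) (mono 0 (k * suc i)) Q ⟩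
    zPart j ⊛ mono 0 E ⊛ (mono 0 (k * suc i) ⊛ Q) ∎
    where
    j E : ℕ
    j = suc (suc i)
    E = exponent k 1 (suc (suc m)) j
    Q : PS
    Q = qbinom k m (suc i)
  ... | no  i≮m = begin
    mono 0 j ⊛ (X ⊛ Q)                         ≈⟨ *-congˡ {mono 0 j} (≈-trans (*-congˡ {X} Q≈0) (zeroʳ X)) ⟩
    mono 0 j ⊛ 0ₚ                              ≈⟨ zeroʳ (mono 0 j) ⟩
    0ₚ                                         ≈⟨ ≈-trans (*-congˡ {Y} (≈-trans (*-congˡ {q^} Q≈0) (zeroʳ q^))) (zeroʳ Y) ⟨
    Y ⊛ (q^ ⊛ Q)                               ∎
    where
    j : ℕ
    j = suc (suc i)
    X Y Q q^ : PS
    X = zPart j ⊛ mono 0 (exponent k k (suc m) j)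
    Y = zPart j ⊛ mono 0 (exponent k 1 (suc (suc m)) j)
    Q = qbinom k m (suc i)
    q^ = mono 0 (k * suc i)
    Q≈0 : Q ≈ₚ 0ₚ
    Q≈0 = qbinom-> k (ℕ.≰⇒> i≮m)

  closedForm-m-step : ∀ k → 1 ≤ k → ∀ m {N} → 1 ≤ N → k ∣ N →
    (∀ j → 1 ≤ j → GLsum k N j ≈ₚ closedForm k k (suc m) j) →
    ∀ j → 1 ≤ j → GLsum k (suc N) j ≈ₚ closedForm k 1 (suc (suc m)) j
  closedForm-m-step k 1≤k m {suc n} _ k∣N GL≈ (suc zero) _ = begin
    GLsum k (suc (suc n)) 1                                      ≈⟨ GLsum-suc-∣ k n (s≤s z≤n) k∣N ⟩
    mono 0 1 ⊛ GLsum k (suc n) 1 ⊕ mono 1 1 ⊛ GLsum k (suc n) 0  ≈⟨ +-congˡ {mono 0 1 ⊛ GLsum k (suc n) 1}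
                                                                     (≈-trans (*-congˡ {mono 1 1} (GLsum-largest-0 k (suc n)))
                                                                              (zeroʳ (mono 1 1))) ⟩
    mono 0 1 ⊛ GLsum k (suc n) 1 ⊕ 0ₚ                             ≈⟨ +-identityʳ _ ⟩
    mono 0 1 ⊛ GLsum k (suc n) 1                                 ≈⟨ *-congˡ {mono 0 1} (GL≈ 1 (s≤s z≤n)) ⟩
    mono 0 1 ⊛ closedForm k k (suc m) 1                          ≈⟨ absorb-q^ (zPart 1) (exponent k k (suc m) 1) 1 (qbinom k m 0) ⟩
    zPart 1 ⊛ mono 0 (exponent k k (suc m) 1 + 1) ⊛ qbinom k m 0  ≈⟨ ⊛-cong exponents binomials ⟩
    closedForm k 1 (suc (suc m)) 1                               ∎
    where
    exponents : zPart 1 ⊛ mono 0 (exponent k k (suc m) 1 + 1) ≈ₚ zPart 1 ⊛ mono 0 (exponent k 1 (suc (suc m)) 1)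
    exponents = reflexive (cong (λ e → zPart 1 ⊛ mono 0 e) (exponent-m-step-1 k m))
    binomials : qbinom k m 0 ≈ₚ qbinom k (suc m) 0
    binomials = ≈-trans (qbinom-0 k 1≤k m) (≈-sym (qbinom-0 k 1≤k (suc m)))
  closedForm-m-step k 1≤k m {suc n} _ k∣N GL≈ j@(suc (suc i)) _ = begin
    GLsum k (suc (suc n)) j
      ≈⟨ GLsum-suc-∣ k n (s≤s z≤n) k∣N ⟩
    mono 0 j ⊛ GLsum k (suc n) j ⊕ mono 1 j ⊛ GLsum k (suc n) (suc i)
      ≈⟨ +-cong (*-congˡ {mono 0 j} (GL≈ j (s≤s z≤n))) (*-congˡ {mono 1 j} (GL≈ (suc i) (s≤s z≤n))) ⟩
    mono 0 j ⊛ closedForm k k (suc m) j ⊕ mono 1 j ⊛ closedForm k k (suc m) (suc i)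
      ≈⟨ +-cong (closedForm-m-step-plain k m i) (closedForm-m-step-over k m i) ⟩
    Z ⊛ (mono 0 (k * suc i) ⊛ qbinom k m (suc i)) ⊕ Z ⊛ qbinom k m i
      ≈⟨ +-comm (Z ⊛ (mono 0 (k * suc i) ⊛ qbinom k m (suc i))) (Z ⊛ qbinom k m i) ⟩
    Z ⊛ qbinom k m i ⊕ Z ⊛ (mono 0 (k * suc i) ⊛ qbinom k m (suc i))
      ≈⟨ distribˡ Z (qbinom k m i) (mono 0 (k * suc i) ⊛ qbinom k m (suc i)) ⟨
    Z ⊛ (qbinom k m i ⊕ mono 0 (k * suc i) ⊛ qbinom k m (suc i))
      ≈⟨ *-congˡ {Z} (qbinom-pascal k 1≤k m i) ⟨
    closedForm k 1 (suc (suc m)) j ∎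
    where
    Z : PS
    Z = zPart j ⊛ mono 0 (exponent k 1 (suc (suc m)) j)

GLsum-closedForm : ∀ k → 1 ≤ k → ∀ m s → 1 ≤ s → s ≤ k → ∀ j → 1 ≤ j →
  GLsum k (k * m + s) j ≈ₚ closedForm k s (suc m) j
GLsum-closedForm k 1≤k zero    (suc zero)    _ _   rewrite ℕ.*-zeroʳ k = closedForm-1 k 1≤k
GLsum-closedForm k 1≤k (suc m) (suc zero)    _ _   j 1≤j =
  ≡.subst (λ N → GLsum k N j ≈ₚ closedForm k 1 (suc (suc m)) j) (≡.sym (k*[1+m]+1≡1+k*m+k k m))
    (closedForm-m-step k 1≤k m (ℕ.≤-trans 1≤k (ℕ.m≤n+m k (k * m))) (k∣k*m+k k m)
      (GLsum-closedForm k 1≤k m k 1≤k ℕ.≤-refl) j 1≤j)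
GLsum-closedForm k 1≤k m       (suc (suc s)) _ s<k j 1≤j =
  ≡.subst (λ N → GLsum k N j ≈ₚ closedForm k (suc (suc s)) (suc m) j) (≡.sym (ℕ.+-suc (k * m) (suc s)))
    (closedForm-s-step k (suc s) (suc m) (ℕ.≤-trans (s≤s z≤n) (ℕ.m≤n+m (suc s) (k * m))) 1≤j
      (k∤k*m+s k m (s≤s z≤n) s<k) (GLsum-closedForm k 1≤k m (suc s) (s≤s z≤n) (ℕ.<⇒≤ s<k) j 1≤j))

theorem3p4 : (k : ℕ) → 1 ≤ k → (s m j : ℕ) → 1 ≤ s → s ≤ k → 1 ≤ j → j ≤ m →
    GL k (k * (m ∸ 1) + s) j false ⊕ GL k (k * (m ∸ 1) + s) j true
      ≈ₚ (mono (j ∸ 1) 0 ⊕ mono j 0) ⊛ mono 0 (k * (j C 2) + s * j + k * (m ∸ j))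
           ⊛ qbinom k (m ∸ 1) (j ∸ 1)
theorem3p4 k 1≤k s zero    j 1≤s s≤k 1≤j j≤0 = ⊥-elim (ℕ.<⇒≱ 1≤j j≤0)
theorem3p4 k 1≤k s (suc m) j 1≤s s≤k 1≤j _   = GLsum-closedForm k 1≤k m s 1≤s s≤k j 1≤j
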